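{- Let $\mathbf{x}$ be a vector of at least $d\ge1$ pairwise different variables, let $A\in\mathbb{Z}^{d\times d}$ be triangular with $A_{i;i}\ge0$ for all $1\le i\le d$, and let $\mathbf{p}\in\mathbb{PE}[\mathbf{x}]^d$. Then one can compute $\mathbf{q}\in\mathbb{PE}[\mathbf{x}]^d$ such that $\mathbf{q}[n/0]=\mathbf{x}_{1,\dots,d}$ and $\mathbf{q}=(A\,\mathbf{q}+\mathbf{p})[n/n-1]$ for all $n>0$.
   Context: $n$ is a designated variable ranging over $\mathbb{N}$. $\mathbb{A}\mathbf{f}[\mathbf{x}]$ denotes the set of affine expressions $\mathbf{c}^T\mathbf{x}+c$ with $\mathbf{c}$, $c$ rational. Let $\mathcal{C}$ be the set of finite conjunctions of literals $n=c$ and $n\neq c$ with $c\in\mathbb{N}$; for a formula $\psi$ over $n$, $[\![\psi]\!]$ is its characteristic function. The poly-exponential expressions over $\mathbf{x}$ are $\mathbb{PE}[\mathbf{x}]=\{\sum_{j=1}^{\ell}[\![\psi_j]\!]\cdot\alpha_j\cdot n^{a_j}\cdot b_j^n \mid \ell,a_j\in\mathbb{N},\ \psi_j\in\mathcal{C},\ \alpha_j\in\mathbb{A}\mathbf{f}[\mathbf{x}],\ b_j\in\mathbb{N}_{\ge1}\}$. $\mathbf{x}_{1,\dots,d}$ is the vector of the first $d$ entries of $\mathbf{x}$; $A_{i;i}$ is the $i$-th diagonal entry; triangular means upper or lower triangular. Substitution $[n/t]$ is applied componentwise. -}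

module Defs where

open import Data.Nat as ℕ using (ℕ; zero; suc; _≤_)
open import Data.Integer as ℤ using (ℤ; +_)
open import Data.Rational using (ℚ; _/_; _+_; _*_; 0ℚ; 1ℚ)
open import Data.Fin using (Fin; zero; suc)
open import Data.Vec using (Vec; lookup)
open import Data.List using (List; []; _∷_)
open import Data.Bool using (Bool; true; false; _∧_; not)
open import Relation.Nullary.Decidable using (⌊_⌋)
open import Relation.Binary.PropositionalEquality using (_≡_)
open import Data.Sum using (_⊎_)
open import Data.Fin using () renaming (_<_ to _<ᶠ_)

ℤ→ℚ : ℤ → ℚ
ℤ→ℚ z = z / 1

ℕ→ℚ : ℕ → ℚ
ℕ→ℚ k = (+ k) / 1

Σℚ : (d : ℕ) → (Fin d → ℚ) → ℚ
Σℚ zero    f = 0ℚ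
Σℚ (suc d) f = f zero + Σℚ d (λ i → f (suc i))

-- Literals  n = c  and  n ≠ c  (c ∈ ℕ); the set 𝒞 = finite conjunctions (lists) of literals
data Literal : Set where
  n≡ : ℕ → Literal
  n≢ : ℕ → Literal

holdsLit : Literal → ℕ → Bool
holdsLit (n≡ c) n = ⌊ n ℕ.≟ c ⌋
holdsLit (n≢ c) n = not ⌊ n ℕ.≟ c ⌋

Conj : Set
Conj = List Literal

holds : Conj → ℕ → Bool
holds []       n = true
holds (l ∷ ls) n = holdsLit l n ∧ holds ls n

⟦_⟧ : Conj → ℕ → ℚ
⟦ ψ ⟧ n with holds ψ n
... | true  = 1ℚ
... | false = 0ℚ

record Affine (m : ℕ) : Set where
  field
    coeffs : Vec ℚ m
    const  : ℚ

evalAff : ∀ {m} → Affine m → (Fin m → ℚ) → ℚ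
evalAff {m} α x = Σℚ m (λ i → lookup (Affine.coeffs α) i * x i) + Affine.const α

-- One summand  ⟦ψ⟧ · α · n^a · b^n  with b ≥ 1
record PETerm (m : ℕ) : Set where
  field
    ψ   : Conj
    α   : Affine m
    a   : ℕ
    b   : ℕ
    1≤b : 1 ≤ b

PE : ℕ → Set
PE m = List (PETerm m)

evalTerm : ∀ {m} → PETerm m → ℕ → (Fin m → ℚ) → ℚ
evalTerm t n x =
  ⟦ PETerm.ψ t ⟧ n * evalAff (PETerm.α t) x
    * ℕ→ℚ (n ℕ.^ PETerm.a t) * ℕ→ℚ (PETerm.b t ℕ.^ n)

evalPE : ∀ {m} → PE m → ℕ → (Fin m → ℚ) → ℚ
evalPE []       n x = 0ℚ
evalPE (t ∷ ts) n x = evalTerm t n x + evalPE ts n x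

UpperTriangular : ∀ {d} → (Fin d → Fin d → ℤ) → Set
UpperTriangular {d} A = ∀ (i j : Fin d) → j <ᶠ i → A i j ≡ + 0

LowerTriangular : ∀ {d} → (Fin d → Fin d → ℤ) → Set
LowerTriangular {d} A = ∀ (i j : Fin d) → i <ᶠ j → A i j ≡ + 0

Triangular : ∀ {d} → (Fin d → Fin d → ℤ) → Set
Triangular A = UpperTriangular A ⊎ LowerTriangular A

module Submission where

-- Row i of q(n+1) = A·q(n) + p(n) is a first-order scalar recurrence
--   q_i(n+1) = l·q_i(n) + f(n),   q_i(0) = γ_i,
-- with l = A_ii ∈ ℕ and f = p_i plus a linear combination of the
-- components that row i depends on.  As A is triangular, the rows can be
-- solved one at a time (solveUpper / solveLower, by induction on d),
-- provided the scalar problem has a poly-exponential solution whenever f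
-- is poly-exponential (solveScalar).  By linearity it suffices to treat one term
--      ⟦ψ⟧·α·n^a·b^n.  Pure terms are expanded in the basis α·C(n,k)·b^n,
--      for which Pascal's rule gives explicit solutions (the resonant case
--      l = b separately); a literal n = c makes a term a multiple of the
--      indicator [n = c]·α, which is solved directly, and n ≠ c subtracts
--      such a multiple.
--   2. Homogeneous terms l^n·γ (or [n = 0]·γ when l = 0) then adjust q(0).

open import Defs
open import Data.Nat using (ℕ; suc; _≤_)
open import Data.Integer using (+_) renaming (_≤_ to _≤ℤ_)
open import Data.Rational using (ℚ; _+_; _*_)
open import Data.Fin using (Fin; inject≤)
open import Data.Product using (Σ; _×_)
open import Relation.Binary.PropositionalEquality using (_≡_)

open import Data.Nat using (zero; _<_)
import Data.Nat as ℕ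
import Data.Nat.Properties as ℕP
open import Data.Nat.Tactic.RingSolver using (solve-∀)
import Data.Nat.Coprimality as Coprime
open import Data.Integer using (ℤ)
import Data.Integer as ℤ
import Data.Integer.Properties as ℤP
open import Data.Rational using (-_; _-_; 1/_; 0ℚ; 1ℚ)
import Data.Rational as ℚ
import Data.Rational.Properties as ℚP
import Data.Rational.Unnormalised as ℚᵘ
import Data.Rational.Unnormalised.Properties as ℚᵘP
open import Data.Rational.Solver using (module +-*-Solver)
open +-*-Solver using (solve; _:=_; _:+_; _:*_; :-_; _:-_; con)
open import Data.Fin using (zero; suc)
import Data.Vec as Vec
import Data.Vec.Properties as VecP
open import Data.List using (List; []; _∷_; _++_)
import Data.List as List
open import Data.Bool using (Bool; true; false; _∧_; not)
open import Data.Product using (_,_; proj₁; proj₂)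
open import Data.Sum using (inj₁; inj₂)
open import Data.Empty using (⊥-elim)
open import Relation.Nullary using (¬_; Dec; yes; no)
open import Relation.Nullary.Decidable using (⌊_⌋)
open import Relation.Binary.Definitions using (tri<; tri≈; tri>)
open import Relation.Binary.PropositionalEquality using (refl; sym; trans; cong; cong₂; module ≡-Reasoning)

ℕ→ℚ-canonical : ∀ k → ℕ→ℚ k ≡ ℚ.mkℚ (+ k) 0 (Coprime.sym (Coprime.1-coprimeTo k))
ℕ→ℚ-canonical k = ℚP.normalize-coprime (Coprime.sym (Coprime.1-coprimeTo k))

ℕ→ℚ-toℚᵘ : ∀ k → ℚ.toℚᵘ (ℕ→ℚ k) ≡ ℚᵘ.mkℚᵘ (+ k) 0
ℕ→ℚ-toℚᵘ k = cong ℚ.toℚᵘ (ℕ→ℚ-canonical k)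

ℕ→ℚ-injective : ∀ a b → ℕ→ℚ a ≡ ℕ→ℚ b → a ≡ b
ℕ→ℚ-injective a b eq =
  ℤP.+-injective (cong ℚ.numerator (trans (sym (ℕ→ℚ-canonical a)) (trans eq (ℕ→ℚ-canonical b))))

ℕ→ℚ-+ : ∀ a b → ℕ→ℚ (a ℕ.+ b) ≡ ℕ→ℚ a + ℕ→ℚ b
ℕ→ℚ-+ a b = ℚP.toℚᵘ-injective (begin
    ℚ.toℚᵘ (ℕ→ℚ (a ℕ.+ b))                           ≈⟨ ℚᵘP.≃-reflexive (ℕ→ℚ-toℚᵘ (a ℕ.+ b)) ⟩
    ℚᵘ.mkℚᵘ (+ (a ℕ.+ b)) 0                          ≈⟨ ℚᵘ.*≡* numerators ⟩
    ℚᵘ.mkℚᵘ (+ a) 0 ℚᵘ.+ ℚᵘ.mkℚᵘ (+ b) 0             ≈⟨ ℚᵘP.≃-reflexive (sym (cong₂ ℚᵘ._+_ (ℕ→ℚ-toℚᵘ a) (ℕ→ℚ-toℚᵘ b))) ⟩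
    ℚ.toℚᵘ (ℕ→ℚ a) ℚᵘ.+ ℚ.toℚᵘ (ℕ→ℚ b)              ≈⟨ ℚᵘP.≃-sym (ℚP.toℚᵘ-homo-+ (ℕ→ℚ a) (ℕ→ℚ b)) ⟩
    ℚ.toℚᵘ (ℕ→ℚ a + ℕ→ℚ b)                           ∎)
  where
  open ℚᵘP.≃-Reasoning
  numerators : + (a ℕ.+ b) ℤ.* + 1 ≡ (+ a ℤ.* + 1 ℤ.+ + b ℤ.* + 1) ℤ.* + 1
  numerators = trans (ℤP.*-identityʳ _) (trans (ℤP.pos-+ a b)
    (sym (trans (ℤP.*-identityʳ _) (cong₂ ℤ._+_ (ℤP.*-identityʳ (+ a)) (ℤP.*-identityʳ (+ b))))))

ℕ→ℚ-* : ∀ a b → ℕ→ℚ (a ℕ.* b) ≡ ℕ→ℚ a * ℕ→ℚ b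
ℕ→ℚ-* a b = ℚP.toℚᵘ-injective (begin
    ℚ.toℚᵘ (ℕ→ℚ (a ℕ.* b))                           ≈⟨ ℚᵘP.≃-reflexive (ℕ→ℚ-toℚᵘ (a ℕ.* b)) ⟩
    ℚᵘ.mkℚᵘ (+ (a ℕ.* b)) 0                          ≈⟨ ℚᵘ.*≡* (cong (ℤ._* + 1) (ℤP.pos-* a b)) ⟩
    ℚᵘ.mkℚᵘ (+ a) 0 ℚᵘ.* ℚᵘ.mkℚᵘ (+ b) 0             ≈⟨ ℚᵘP.≃-reflexive (sym (cong₂ ℚᵘ._*_ (ℕ→ℚ-toℚᵘ a) (ℕ→ℚ-toℚᵘ b))) ⟩
    ℚ.toℚᵘ (ℕ→ℚ a) ℚᵘ.* ℚ.toℚᵘ (ℕ→ℚ b)              ≈⟨ ℚᵘP.≃-sym (ℚP.toℚᵘ-homo-* (ℕ→ℚ a) (ℕ→ℚ b)) ⟩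
    ℚ.toℚᵘ (ℕ→ℚ a * ℕ→ℚ b)                           ∎)
  where open ℚᵘP.≃-Reasoning

ℕ→ℚ-^suc : ∀ b n → ℕ→ℚ (b ℕ.^ suc n) ≡ ℕ→ℚ b * ℕ→ℚ (b ℕ.^ n)
ℕ→ℚ-^suc b n = ℕ→ℚ-* b (b ℕ.^ n)

ℕ→ℚ-nonZero : ∀ k .{{_ : ℕ.NonZero k}} → ℚ.NonZero (ℕ→ℚ k)
ℕ→ℚ-nonZero k = ℚ.≢-nonZero (λ eq → ℕ.≢-nonZero⁻¹ k (ℕ→ℚ-injective k 0 eq))

inv : (k : ℕ) .{{_ : ℕ.NonZero k}} → ℚ
inv k = (1/ ℕ→ℚ k) {{ℕ→ℚ-nonZero k}}

inv-inverseʳ : ∀ k .{{_ : ℕ.NonZero k}} → ℕ→ℚ k * inv k ≡ 1ℚ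
inv-inverseʳ k = ℚP.*-inverseʳ (ℕ→ℚ k) {{ℕ→ℚ-nonZero k}}

Σℚ-cong : ∀ d {f g : Fin d → ℚ} → (∀ i → f i ≡ g i) → Σℚ d f ≡ Σℚ d g
Σℚ-cong zero    eq = refl
Σℚ-cong (suc d) eq = cong₂ _+_ (eq zero) (Σℚ-cong d (λ i → eq (suc i)))

Σℚ-zero : ∀ d → Σℚ d (λ _ → 0ℚ) ≡ 0ℚ
Σℚ-zero zero    = refl
Σℚ-zero (suc d) = cong (_+_ 0ℚ) (Σℚ-zero d)

Σℚ-scale : ∀ d r (f : Fin d → ℚ) → Σℚ d (λ i → r * f i) ≡ r * Σℚ d f
Σℚ-scale zero    r f = sym (ℚP.*-zeroʳ r)
Σℚ-scale (suc d) r f =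
  trans (cong (_+_ (r * f zero)) (Σℚ-scale d r (λ i → f (suc i)))) (sym (ℚP.*-distribˡ-+ r (f zero) _))

scaleAff : ∀ {m} → ℚ → Affine m → Affine m
scaleAff r α = record { coeffs = Vec.map (r *_) (Affine.coeffs α) ; const = r * Affine.const α }

evalAff-scale : ∀ {m} r (α : Affine m) x → evalAff (scaleAff r α) x ≡ r * evalAff α x
evalAff-scale {m} r α x = trans (cong (_+ r * Affine.const α) linear) (sym (ℚP.*-distribˡ-+ r _ _))
  where
  coeff : ∀ i → Vec.lookup (Affine.coeffs (scaleAff r α)) i * x i ≡ r * (Vec.lookup (Affine.coeffs α) i * x i)
  coeff i = trans (cong (_* x i) (VecP.lookup-map i (r *_) (Affine.coeffs α))) (ℚP.*-assoc r _ _)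
  linear : Σℚ m (λ i → Vec.lookup (Affine.coeffs (scaleAff r α)) i * x i)
         ≡ r * Σℚ m (λ i → Vec.lookup (Affine.coeffs α) i * x i)
  linear = trans (Σℚ-cong m coeff) (Σℚ-scale m r _)

δ : ∀ {m} → Fin m → Fin m → ℚ
δ zero    zero    = 1ℚ
δ zero    (suc _) = 0ℚ
δ (suc _) zero    = 0ℚ
δ (suc i) (suc j) = δ i j

Σℚ-δ : ∀ m (k : Fin m) (x : Fin m → ℚ) → Σℚ m (λ i → δ i k * x i) ≡ x k
Σℚ-δ (suc m) zero x = begin
  1ℚ * x zero + Σℚ m (λ i → 0ℚ * x (suc i))  ≡⟨ cong (_+_ (1ℚ * x zero)) (trans (Σℚ-cong m (λ i → ℚP.*-zeroˡ (x (suc i)))) (Σℚ-zero m)) ⟩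
  1ℚ * x zero + 0ℚ                            ≡⟨ ℚP.+-identityʳ _ ⟩
  1ℚ * x zero                                 ≡⟨ ℚP.*-identityˡ _ ⟩
  x zero                                      ∎
  where open ≡-Reasoning
Σℚ-δ (suc m) (suc k) x = begin
  0ℚ * x zero + Σℚ m (λ i → δ i k * x (suc i))  ≡⟨ cong (_+ Σℚ m (λ i → δ i k * x (suc i))) (ℚP.*-zeroˡ (x zero)) ⟩
  0ℚ + Σℚ m (λ i → δ i k * x (suc i))           ≡⟨ ℚP.+-identityˡ _ ⟩
  Σℚ m (λ i → δ i k * x (suc i))                ≡⟨ Σℚ-δ m k (λ i → x (suc i)) ⟩
  x (suc k)                                     ∎
  where open ≡-Reasoning

var : ∀ {m} → Fin m → Affine m
var k = record { coeffs = Vec.tabulate (λ i → δ i k) ; const = 0ℚ }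

evalAff-var : ∀ {m} (k : Fin m) x → evalAff (var k) x ≡ x k
evalAff-var {m} k x = trans (ℚP.+-identityʳ _)
  (trans (Σℚ-cong m (λ i → cong (_* x i) (VecP.lookup∘tabulate (λ i → δ i k) i))) (Σℚ-δ m k x))

𝟙 : Bool → ℚ
𝟙 true  = 1ℚ
𝟙 false = 0ℚ

⟦⟧≡𝟙 : ∀ ψ n → ⟦ ψ ⟧ n ≡ 𝟙 (holds ψ n)
⟦⟧≡𝟙 ψ n with holds ψ n
... | true  = refl
... | false = refl

𝟙-∧ : ∀ u v → 𝟙 (u ∧ v) ≡ 𝟙 u * 𝟙 v
𝟙-∧ true  true  = refl
𝟙-∧ true  false = refl
𝟙-∧ false true  = refl
𝟙-∧ false false = refl

⟦∷⟧ : ∀ l ψ n → ⟦ l ∷ ψ ⟧ n ≡ 𝟙 (holdsLit l n) * ⟦ ψ ⟧ n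
⟦∷⟧ l ψ n = trans (⟦⟧≡𝟙 (l ∷ ψ) n) (trans (𝟙-∧ (holdsLit l n) (holds ψ n)) (cong (𝟙 (holdsLit l n) *_) (sym (⟦⟧≡𝟙 ψ n))))

at : ℕ → ℕ → ℚ
at c n = ⟦ n≡ c ∷ [] ⟧ n

at-dec : ∀ c n → at c n ≡ 𝟙 ⌊ n ℕ.≟ c ⌋
at-dec c n = trans (⟦∷⟧ (n≡ c) [] n) (ℚP.*-identityʳ _)

at-self : ∀ c → at c c ≡ 1ℚ
at-self c = trans (at-dec c c) (is1 (c ℕ.≟ c))
  where
  is1 : (c≟c : Dec (c ≡ c)) → 𝟙 ⌊ c≟c ⌋ ≡ 1ℚ
  is1 (yes _)  = refl
  is1 (no c≢c) = ⊥-elim (c≢c refl)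

at-other : ∀ c n → ¬ n ≡ c → at c n ≡ 0ℚ
at-other c n n≢c = trans (at-dec c n) (is0 (n ℕ.≟ c))
  where
  is0 : (n≟c : Dec (n ≡ c)) → 𝟙 ⌊ n≟c ⌋ ≡ 0ℚ
  is0 (yes n≡c) = ⊥-elim (n≢c n≡c)
  is0 (no _)    = refl

at-sift : ∀ c n (g : ℕ → ℚ) → at c n * g n ≡ at c n * g c
at-sift c n g = by-cases (n ℕ.≟ c)
  where
  by-cases : Dec (n ≡ c) → at c n * g n ≡ at c n * g c
  by-cases (yes refl) = refl
  by-cases (no n≢c)   = trans (zero-left (g n)) (sym (zero-left (g c)))
    where
    zero-left : ∀ r → at c n * r ≡ 0ℚ
    zero-left r = trans (cong (_* r) (at-other c n n≢c)) (ℚP.*-zeroˡ r)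

at-suc : ∀ c n → at (suc c) (suc n) ≡ at c n
at-suc c n = by-cases (n ℕ.≟ c)
  where
  by-cases : Dec (n ≡ c) → at (suc c) (suc n) ≡ at c n
  by-cases (yes refl) = trans (at-self (suc n)) (sym (at-self n))
  by-cases (no n≢c)   =
    trans (at-other (suc c) (suc n) (λ eq → n≢c (ℕP.suc-injective eq))) (sym (at-other c n n≢c))

⟦n≡∷⟧ : ∀ c ψ n → ⟦ n≡ c ∷ ψ ⟧ n ≡ at c n * ⟦ ψ ⟧ n
⟦n≡∷⟧ c ψ n = trans (⟦∷⟧ (n≡ c) ψ n) (cong (_* ⟦ ψ ⟧ n) (sym (at-dec c n)))

⟦n≢∷⟧ : ∀ c ψ n → ⟦ n≢ c ∷ ψ ⟧ n ≡ (1ℚ - at c n) * ⟦ ψ ⟧ n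
⟦n≢∷⟧ c ψ n = trans (⟦∷⟧ (n≢ c) ψ n) (cong (_* ⟦ ψ ⟧ n) (trans (𝟙-not ⌊ n ℕ.≟ c ⌋) (cong (_-_ 1ℚ) (sym (at-dec c n)))))
  where
  𝟙-not : ∀ u → 𝟙 (not u) ≡ 1ℚ - 𝟙 u
  𝟙-not true  = refl
  𝟙-not false = refl

-- The tail indicator [n > c], expressed in 𝒞 as n ≠ c ∧ … ∧ n ≠ 0.
beyond : ℕ → Conj
beyond zero    = n≢ 0 ∷ []
beyond (suc c) = n≢ (suc c) ∷ beyond c

holds-beyond : ∀ c n → c < n → holds (beyond c) n ≡ true
holds-beyond zero    n c<n with n ℕ.≟ 0
... | yes refl = ⊥-elim (ℕP.<-irrefl refl c<n)
... | no _     = refl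
holds-beyond (suc c) n c<n with n ℕ.≟ suc c
... | yes refl = ⊥-elim (ℕP.<-irrefl refl c<n)
... | no _     = holds-beyond c n (ℕP.<-trans (ℕP.n<1+n c) c<n)

fails-beyond : ∀ c n → n ≤ c → holds (beyond c) n ≡ false
fails-beyond zero    n n≤c with n ℕ.≟ 0
... | yes refl = refl
... | no n≢0   = ⊥-elim (n≢0 (ℕP.n≤0⇒n≡0 n≤c))
fails-beyond (suc c) n n≤c with n ℕ.≟ suc c
... | yes refl = refl
... | no n≢c   = fails-beyond c n (ℕP.≤-pred (ℕP.≤∧≢⇒< n≤c n≢c))

beyond-step : ∀ c n → ⟦ beyond c ⟧ (suc n) ≡ at c n + ⟦ beyond c ⟧ n
beyond-step c n with ℕP.<-cmp n c
... | tri< n<c n≢c _ rewrite ⟦⟧≡𝟙 (beyond c) (suc n) | fails-beyond c (suc n) n<c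
                           | at-other c n n≢c | ⟦⟧≡𝟙 (beyond c) n | fails-beyond c n (ℕP.<⇒≤ n<c) = refl
... | tri≈ _ refl _  rewrite ⟦⟧≡𝟙 (beyond n) (suc n) | holds-beyond n (suc n) ℕP.≤-refl
                           | at-self n | ⟦⟧≡𝟙 (beyond n) n | fails-beyond n n ℕP.≤-refl = refl
... | tri> _ n≢c c<n rewrite ⟦⟧≡𝟙 (beyond c) (suc n) | holds-beyond c (suc n) (ℕP.<-trans c<n (ℕP.n<1+n n))
                           | at-other c n n≢c | ⟦⟧≡𝟙 (beyond c) n | holds-beyond c n c<n = refl

evalPE-++ : ∀ {m} (e e′ : PE m) n x → evalPE (e ++ e′) n x ≡ evalPE e n x + evalPE e′ n x
evalPE-++ []      e′ n x = sym (ℚP.+-identityˡ _)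
evalPE-++ (t ∷ e) e′ n x =
  trans (cong (_+_ (evalTerm t n x)) (evalPE-++ e e′ n x)) (sym (ℚP.+-assoc (evalTerm t n x) _ _))

scalePE : ∀ {m} → ℚ → PE m → PE m
scalePE r = List.map λ t → record t { α = scaleAff r (PETerm.α t) }

evalPE-scale : ∀ {m} r (e : PE m) n x → evalPE (scalePE r e) n x ≡ r * evalPE e n x
evalPE-scale r []      n x = sym (ℚP.*-zeroʳ r)
evalPE-scale r (t ∷ e) n x =
  trans (cong₂ _+_ term (evalPE-scale r e n x)) (sym (ℚP.*-distribˡ-+ r _ _))
  where
  term : evalTerm (record t { α = scaleAff r (PETerm.α t) }) n x ≡ r * evalTerm t n x
  term rewrite evalAff-scale r (PETerm.α t) x =
    solve 5 (λ P r α N B → P :* (r :* α) :* N :* B := r :* (P :* α :* N :* B)) refl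
      (⟦ PETerm.ψ t ⟧ n) r (evalAff (PETerm.α t) x) (ℕ→ℚ (n ℕ.^ PETerm.a t)) (ℕ→ℚ (PETerm.b t ℕ.^ n))

mulPE : ∀ {m} → PE m → PE m
mulPE = List.map λ t → record t { a = suc (PETerm.a t) }

evalPE-mul : ∀ {m} (e : PE m) n x → evalPE (mulPE e) n x ≡ ℕ→ℚ n * evalPE e n x
evalPE-mul []      n x = sym (ℚP.*-zeroʳ (ℕ→ℚ n))
evalPE-mul (t ∷ e) n x =
  trans (cong₂ _+_ term (evalPE-mul e n x)) (sym (ℚP.*-distribˡ-+ (ℕ→ℚ n) _ _))
  where
  term : evalTerm (record t { a = suc (PETerm.a t) }) n x ≡ ℕ→ℚ n * evalTerm t n x
  term rewrite ℕ→ℚ-* n (n ℕ.^ PETerm.a t) =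
    solve 5 (λ P α N M B → P :* α :* (N :* M) :* B := N :* (P :* α :* M :* B)) refl
      (⟦ PETerm.ψ t ⟧ n) (evalAff (PETerm.α t) x) (ℕ→ℚ n) (ℕ→ℚ (n ℕ.^ PETerm.a t)) (ℕ→ℚ (PETerm.b t ℕ.^ n))

Seq : ℕ → Set
Seq m = ℕ → (Fin m → ℚ) → ℚ

Rep : ∀ {m} → Seq m → Set
Rep {m} f = Σ (PE m) λ e → ∀ n x → evalPE e n x ≡ f n x

rep-ext : ∀ {m} {f g : Seq m} → (∀ n x → f n x ≡ g n x) → Rep f → Rep g
rep-ext f≡g (e , e≡f) = e , λ n x → trans (e≡f n x) (f≡g n x)

rep-+ : ∀ {m} {f g : Seq m} → Rep f → Rep g → Rep (λ n x → f n x + g n x)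
rep-+ (e , e≡f) (e′ , e′≡g) = e ++ e′ , λ n x → trans (evalPE-++ e e′ n x) (cong₂ _+_ (e≡f n x) (e′≡g n x))

rep-scale : ∀ {m} {f : Seq m} r → Rep f → Rep (λ n x → r * f n x)
rep-scale r (e , e≡f) = scalePE r e , λ n x → trans (evalPE-scale r e n x) (cong (r *_) (e≡f n x))

rep-mul : ∀ {m} {f : Seq m} → Rep f → Rep (λ n x → ℕ→ℚ n * f n x)
rep-mul (e , e≡f) = mulPE e , λ n x → trans (evalPE-mul e n x) (cong (ℕ→ℚ n *_) (e≡f n x))

Solves : ∀ {m} → ℕ → Seq m → Seq m → Set
Solves l f G = ∀ n x → G (suc n) x ≡ ℕ→ℚ l * G n x + f n x

record Solvable {m} (l : ℕ) (f : Seq m) : Set where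
  constructor solvable
  field
    particular : Seq m
    representable : Rep particular
    solves : Solves l f particular

solvable-ext : ∀ {m l} {f g : Seq m} → (∀ n x → f n x ≡ g n x) → Solvable l f → Solvable l g
solvable-ext {l = l} f≡g (solvable G rep sol) = solvable G rep λ n x → trans (sol n x) (cong (_+_ (ℕ→ℚ l * G n x)) (f≡g n x))

solvable-+ : ∀ {m l} {f g : Seq m} → Solvable l f → Solvable l g → Solvable l (λ n x → f n x + g n x)
solvable-+ {l = l} {f} {g} (solvable G rep sol) (solvable H rep′ sol′) =
  solvable (λ n x → G n x + H n x) (rep-+ rep rep′) λ n x → trans (cong₂ _+_ (sol n x) (sol′ n x))
    (solve 5 (λ L G H F K → (L :* G :+ F) :+ (L :* H :+ K) := L :* (G :+ H) :+ (F :+ K)) refl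
      (ℕ→ℚ l) (G n x) (H n x) (f n x) (g n x))

solvable-scale : ∀ {m l} {f : Seq m} r → Solvable l f → Solvable l (λ n x → r * f n x)
solvable-scale {l = l} {f} r (solvable G rep sol) =
  solvable (λ n x → r * G n x) (rep-scale r rep) λ n x → trans (cong (r *_) (sol n x))
    (solve 4 (λ r L G F → r :* (L :* G :+ F) := L :* (r :* G) :+ r :* F) refl r (ℕ→ℚ l) (G n x) (f n x))

binom : ℕ → ℕ → ℕ
binom n       zero    = 1
binom zero    (suc k) = 0
binom (suc n) (suc k) = binom n k ℕ.+ binom n (suc k)

binom-1 : ∀ n → binom n 1 ≡ n
binom-1 zero    = refl
binom-1 (suc n) = cong suc (binom-1 n)

-- Absorption: n·C(n,k) = (k+1)·C(n,k+1) + k·C(n,k).  It rewrites a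
-- factor n in the binomial basis, both to represent C(n,k)·b^n and to
-- reduce n^a·C(n,k)·b^n to lower powers of n.
absorb : ∀ n k → n ℕ.* binom n k ≡ suc k ℕ.* binom n (suc k) ℕ.+ k ℕ.* binom n k
absorb zero    zero    = refl
absorb zero    (suc k) = sym (cong₂ ℕ._+_ (ℕP.*-zeroʳ (suc (suc k))) (ℕP.*-zeroʳ (suc k)))
absorb (suc n) zero rewrite binom-1 n = unit n
  where
  unit : ∀ n → suc n ℕ.* 1 ≡ 1 ℕ.* suc n ℕ.+ 0 ℕ.* 1
  unit = solve-∀
absorb (suc n) (suc j) = begin
  suc n ℕ.* (A ℕ.+ B)                                                  ≡⟨ expand n A B ⟩
  A ℕ.+ B ℕ.+ n ℕ.* A ℕ.+ n ℕ.* B                                      ≡⟨ cong₂ (λ u v → A ℕ.+ B ℕ.+ u ℕ.+ v) (absorb n j) (absorb n (suc j)) ⟩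
  A ℕ.+ B ℕ.+ (suc j ℕ.* B ℕ.+ j ℕ.* A) ℕ.+ (suc (suc j) ℕ.* C ℕ.+ suc j ℕ.* B) ≡⟨ regroup j A B C ⟩
  suc (suc j) ℕ.* (B ℕ.+ C) ℕ.+ suc j ℕ.* (A ℕ.+ B)                    ∎
  where
  open ≡-Reasoning
  A = binom n j
  B = binom n (suc j)
  C = binom n (suc (suc j))
  expand : ∀ n A B → suc n ℕ.* (A ℕ.+ B) ≡ A ℕ.+ B ℕ.+ n ℕ.* A ℕ.+ n ℕ.* B
  expand = solve-∀
  regroup : ∀ j A B C → A ℕ.+ B ℕ.+ (suc j ℕ.* B ℕ.+ j ℕ.* A) ℕ.+ (suc (suc j) ℕ.* C ℕ.+ suc j ℕ.* B)
                      ≡ suc (suc j) ℕ.* (B ℕ.+ C) ℕ.+ suc j ℕ.* (A ℕ.+ B)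
  regroup = solve-∀

Cℚ : ℕ → ℕ → ℚ
Cℚ n k = ℕ→ℚ (binom n k)

absorbℚ : ∀ n k → ℕ→ℚ n * Cℚ n k ≡ ℕ→ℚ (suc k) * Cℚ n (suc k) + ℕ→ℚ k * Cℚ n k
absorbℚ n k = begin
  ℕ→ℚ n * Cℚ n k                                             ≡⟨ ℕ→ℚ-* n (binom n k) ⟨
  ℕ→ℚ (n ℕ.* binom n k)                                      ≡⟨ cong ℕ→ℚ (absorb n k) ⟩
  ℕ→ℚ (suc k ℕ.* binom n (suc k) ℕ.+ k ℕ.* binom n k)        ≡⟨ ℕ→ℚ-+ (suc k ℕ.* binom n (suc k)) (k ℕ.* binom n k) ⟩
  ℕ→ℚ (suc k ℕ.* binom n (suc k)) + ℕ→ℚ (k ℕ.* binom n k)    ≡⟨ cong₂ _+_ (ℕ→ℚ-* (suc k) (binom n (suc k))) (ℕ→ℚ-* k (binom n k)) ⟩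
  ℕ→ℚ (suc k) * Cℚ n (suc k) + ℕ→ℚ k * Cℚ n k               ∎
  where open ≡-Reasoning

binomExp : ∀ {m} → Affine m → ℕ → ℕ → Seq m
binomExp β b k n x = evalAff β x * Cℚ n k * ℕ→ℚ (b ℕ.^ n)

binomExp-suc : ∀ {m} (β : Affine m) b k n x →
  binomExp β b (suc k) (suc n) x ≡ ℕ→ℚ b * binomExp β b k n x + ℕ→ℚ b * binomExp β b (suc k) n x
binomExp-suc β b k n x =
  trans (cong₂ (λ C B → evalAff β x * C * B) (ℕ→ℚ-+ (binom n k) (binom n (suc k))) (ℕ→ℚ-^suc b n)) (
  solve 5 (λ α C C′ b B → α :* (C :+ C′) :* (b :* B) := b :* (α :* C :* B) :+ b :* (α :* C′ :* B)) refl
    (evalAff β x) (Cℚ n k) (Cℚ n (suc k)) (ℕ→ℚ b) (ℕ→ℚ (b ℕ.^ n)))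

binomExp-suc₀ : ∀ {m} (β : Affine m) b n x → binomExp β b 0 (suc n) x ≡ ℕ→ℚ b * binomExp β b 0 n x
binomExp-suc₀ β b n x = trans (cong (evalAff β x * Cℚ n 0 *_) (ℕ→ℚ-^suc b n))
  (solve 4 (λ α C b B → α :* C :* (b :* B) := b :* (α :* C :* B)) refl (evalAff β x) (Cℚ n 0) (ℕ→ℚ b) (ℕ→ℚ (b ℕ.^ n)))

-- The basis sequences are poly-exponential: C(n,0)·b^n is a single term,
-- and C(n,k+1) = (n·C(n,k) − k·C(n,k))/(k+1) by absorption.
rep-binomExp : ∀ {m} (β : Affine m) b → 1 ≤ b → ∀ k → Rep (binomExp β b k)
rep-binomExp β b 1≤b zero = record { ψ = [] ; α = β ; a = 0 ; b = b ; 1≤b = 1≤b } ∷ [] , λ n x →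
  solve 2 (λ α B → con 1ℚ :* α :* con 1ℚ :* B :+ con 0ℚ := α :* con 1ℚ :* B) refl (evalAff β x) (ℕ→ℚ (b ℕ.^ n))
rep-binomExp β b 1≤b (suc k) =
  rep-ext divide (rep-scale (inv (suc k)) (rep-+ (rep-mul previous) (rep-scale (- ℕ→ℚ k) previous)))
  where
  previous = rep-binomExp β b 1≤b k
  divide : ∀ n x → inv (suc k) * (ℕ→ℚ n * binomExp β b k n x + (- ℕ→ℚ k) * binomExp β b k n x)
                 ≡ binomExp β b (suc k) n x
  divide n x = begin
    r * (N * (α * C * B) + (- K) * (α * C * B))  ≡⟨ solve 6 (λ r N α C B K → r :* (N :* (α :* C :* B) :+ (:- K) :* (α :* C :* B))
                                                                        := r :* (α :* B) :* (N :* C :+ :- (K :* C))) refl r N α C B K ⟩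
    r * (α * B) * (N * C + - (K * C))           ≡⟨ cong (λ z → r * (α * B) * (z + - (K * C))) (absorbℚ n k) ⟩
    r * (α * B) * (S * C′ + K * C + - (K * C))  ≡⟨ solve 7 (λ r α B S C′ K C → r :* (α :* B) :* (S :* C′ :+ K :* C :+ :- (K :* C))
                                                                        := (S :* r) :* (α :* C′ :* B)) refl r α B S C′ K C ⟩
    (S * r) * (α * C′ * B)                      ≡⟨ cong (_* (α * C′ * B)) (inv-inverseʳ (suc k)) ⟩
    1ℚ * (α * C′ * B)                           ≡⟨ ℚP.*-identityˡ _ ⟩
    α * C′ * B                                  ∎
    where
    open ≡-Reasoning
    r = inv (suc k)
    N = ℕ→ℚ n
    K = ℕ→ℚ k
    S = ℕ→ℚ (suc k)
    α = evalAff β x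
    C = Cℚ n k
    C′ = Cℚ n (suc k)
    B = ℕ→ℚ (b ℕ.^ n)

-- Particular solutions for the basis sequences.  In the resonant case
-- l = b, G = β·C(n,k+1)·b^n / b works, as shifting n raises k.
solvable-binomExp-resonant : ∀ {m} (β : Affine m) b′ k → Solvable (suc b′) (binomExp β (suc b′) k)
solvable-binomExp-resonant β b′ k =
  solvable (λ n x → r * binomExp β b (suc k) n x) (rep-scale r (rep-binomExp β b (ℕ.s≤s ℕ.z≤n) (suc k))) rec
  where
  b = suc b′
  r = inv b
  rec : Solves b (binomExp β b k) (λ n x → r * binomExp β b (suc k) n x)
  rec n x = begin
    r * binomExp β b (suc k) (suc n) x  ≡⟨ cong (r *_) (binomExp-suc β b k n x) ⟩
    r * (B * E + B * E′)                ≡⟨ solve 4 (λ r B E E′ → r :* (B :* E :+ B :* E′) := B :* (r :* E′) :+ (B :* r) :* E) refl r B E E′ ⟩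
    B * (r * E′) + (B * r) * E          ≡⟨ cong (λ z → B * (r * E′) + z * E) (inv-inverseʳ b) ⟩
    B * (r * E′) + 1ℚ * E               ≡⟨ cong (_+_ (B * (r * E′))) (ℚP.*-identityˡ E) ⟩
    B * (r * E′) + E                    ∎
    where
    open ≡-Reasoning
    B = ℕ→ℚ b
    E = binomExp β b k n x
    E′ = binomExp β b (suc k) n x

-- In the non-resonant case l ≠ b, with s = 1/(b − l): G = s·β·C(n,0)·b^n
-- for k = 0, and G = s·(β·C(n,k+1)·b^n − H) for k+1, where H is a
-- particular solution for b·β·C(n,k)·b^n.
solvable-binomExp-nonresonant : ∀ {m} (β : Affine m) l b → 1 ≤ b → ¬ l ≡ b → ∀ k → Solvable l (binomExp β b k)
solvable-binomExp-nonresonant {m} β l b 1≤b l≢b = go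
  where
  L = ℕ→ℚ l
  B = ℕ→ℚ b
  D = B - L
  D≢0 : ¬ D ≡ 0ℚ
  D≢0 D≡0 = l≢b (sym (ℕ→ℚ-injective b l (begin
    B            ≡⟨ solve 2 (λ B L → B := (B :- L) :+ L) refl B L ⟩
    D + L        ≡⟨ cong (_+ L) D≡0 ⟩
    0ℚ + L       ≡⟨ ℚP.+-identityˡ L ⟩
    L            ∎)))
    where open ≡-Reasoning
  instance
    D-nonZero : ℚ.NonZero D
    D-nonZero = ℚ.≢-nonZero D≢0
  s = 1/ D
  D*s≡1 : D * s ≡ 1ℚ
  D*s≡1 = ℚP.*-inverseʳ D
  go : ∀ k → Solvable l (binomExp β b k)
  go zero = solvable (λ n x → s * binomExp β b 0 n x) (rep-scale s (rep-binomExp β b 1≤b 0)) rec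
    where
    rec : Solves l (binomExp β b 0) (λ n x → s * binomExp β b 0 n x)
    rec n x = begin
      s * binomExp β b 0 (suc n) x  ≡⟨ cong (s *_) (binomExp-suc₀ β b n x) ⟩
      s * (B * E)                   ≡⟨ solve 4 (λ s B L E → s :* (B :* E) := ((B :- L) :* s) :* E :+ L :* (s :* E)) refl s B L E ⟩
      (D * s) * E + L * (s * E)     ≡⟨ cong (λ z → z * E + L * (s * E)) D*s≡1 ⟩
      1ℚ * E + L * (s * E)          ≡⟨ solve 2 (λ E Y → con 1ℚ :* E :+ Y := Y :+ E) refl E (L * (s * E)) ⟩
      L * (s * E) + E               ∎
      where
      open ≡-Reasoning
      E = binomExp β b 0 n x
  go (suc k) = solvable G rep rec
    where
    H : Solvable l (λ n x → B * binomExp β b k n x)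
    H = solvable-scale B (go k)
    h = Solvable.particular H
    G : Seq m
    G n x = s * (binomExp β b (suc k) n x - h n x)
    rep : Rep G
    rep = rep-ext (λ n x → solve 3 (λ s E h → s :* (E :+ (:- con 1ℚ) :* h) := s :* (E :- h)) refl s (binomExp β b (suc k) n x) (h n x))
            (rep-scale s (rep-+ (rep-binomExp β b 1≤b (suc k)) (rep-scale (- 1ℚ) (Solvable.representable H))))
    rec : Solves l (binomExp β b (suc k)) G
    rec n x = begin
      s * (binomExp β b (suc k) (suc n) x - h (suc n) x)  ≡⟨ cong₂ (λ u v → s * (u - v)) (binomExp-suc β b k n x) (Solvable.solves H n x) ⟩
      s * ((B * E + B * E′) - (L * h n x + B * E))        ≡⟨ solve 6 (λ s B L E E′ h → s :* ((B :* E :+ B :* E′) :- (L :* h :+ B :* E))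
                                                                               := ((B :- L) :* s) :* E′ :+ L :* (s :* (E′ :- h))) refl s B L E E′ (h n x) ⟩
      (D * s) * E′ + L * G n x                            ≡⟨ cong (λ z → z * E′ + L * G n x) D*s≡1 ⟩
      1ℚ * E′ + L * G n x                                 ≡⟨ solve 2 (λ E Y → con 1ℚ :* E :+ Y := Y :+ E) refl E′ (L * G n x) ⟩
      L * G n x + E′                                      ∎
      where
      open ≡-Reasoning
      E = binomExp β b k n x
      E′ = binomExp β b (suc k) n x

solvable-binomExp : ∀ {m} (β : Affine m) l b → 1 ≤ b → ∀ k → Solvable l (binomExp β b k)
solvable-binomExp β l b 1≤b k with l ℕ.≟ b
solvable-binomExp β l (suc b′) 1≤b k | yes refl = solvable-binomExp-resonant β b′ k
... | no l≢b = solvable-binomExp-nonresonant β l b 1≤b l≢b k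

-- Pure terms β·n^a·b^n.  Absorption gives
--   n^(a+1)·C(n,k) = n^a·((k+1)·C(n,k+1) + k·C(n,k)),
-- so induction on a (for all k at once) reduces everything to the basis.
solvable-pow-binomExp : ∀ {m} (β : Affine m) l b → 1 ≤ b → ∀ a k →
  Solvable l (λ n x → ℕ→ℚ (n ℕ.^ a) * binomExp β b k n x)
solvable-pow-binomExp β l b 1≤b zero k =
  solvable-ext (λ n x → sym (ℚP.*-identityˡ _)) (solvable-binomExp β l b 1≤b k)
solvable-pow-binomExp β l b 1≤b (suc a) k =
  solvable-ext absorbed
    (solvable-+ (solvable-scale (ℕ→ℚ (suc k)) (solvable-pow-binomExp β l b 1≤b a (suc k)))
                (solvable-scale (ℕ→ℚ k) (solvable-pow-binomExp β l b 1≤b a k)))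
  where
  absorbed : ∀ n x → ℕ→ℚ (suc k) * (ℕ→ℚ (n ℕ.^ a) * binomExp β b (suc k) n x) + ℕ→ℚ k * (ℕ→ℚ (n ℕ.^ a) * binomExp β b k n x)
                   ≡ ℕ→ℚ (n ℕ.^ suc a) * binomExp β b k n x
  absorbed n x = begin
    S * (P * (α * C′ * B)) + K * (P * (α * C * B))  ≡⟨ solve 7 (λ S P α C′ B K C → S :* (P :* (α :* C′ :* B)) :+ K :* (P :* (α :* C :* B))
                                                                          := P :* α :* B :* (S :* C′ :+ K :* C)) refl S P α C′ B K C ⟩
    P * α * B * (S * C′ + K * C)                    ≡⟨ cong (P * α * B *_) (absorbℚ n k) ⟨
    P * α * B * (N * C)                             ≡⟨ solve 5 (λ P α B N C → P :* α :* B :* (N :* C) := (N :* P) :* (α :* C :* B)) refl P α B N C ⟩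
    (N * P) * (α * C * B)                           ≡⟨ cong (_* (α * C * B)) (ℕ→ℚ-* n (n ℕ.^ a)) ⟨
    ℕ→ℚ (n ℕ.^ suc a) * (α * C * B)                 ∎
    where
    open ≡-Reasoning
    S = ℕ→ℚ (suc k)
    K = ℕ→ℚ k
    N = ℕ→ℚ n
    P = ℕ→ℚ (n ℕ.^ a)
    α = evalAff β x
    C = Cℚ n k
    C′ = Cℚ n (suc k)
    B = ℕ→ℚ (b ℕ.^ n)

solvable-pure : ∀ {m} (β : Affine m) l b → 1 ≤ b → ∀ a →
  Solvable l (λ n x → evalAff β x * ℕ→ℚ (n ℕ.^ a) * ℕ→ℚ (b ℕ.^ n))
solvable-pure β l b 1≤b a =
  solvable-ext (λ n x → solve 3 (λ P α B → P :* (α :* con 1ℚ :* B) := α :* P :* B) refl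
                          (ℕ→ℚ (n ℕ.^ a)) (evalAff β x) (ℕ→ℚ (b ℕ.^ n)))
    (solvable-pow-binomExp β l b 1≤b a 0)

-- Point indicators [n = c]·β.  For l = 0 the shifted indicator
-- [n = c+1]·β is a solution; for l ≥ 1 the tail [n > c]·β·l^(n−c−1) is.
solvable-at : ∀ {m} (β : Affine m) l c → Solvable l (λ n x → at c n * evalAff β x)
solvable-at {m} β zero c = solvable G ((shifted ∷ []) , λ n x → refl) rec
  where
  shifted : PETerm m
  shifted = record { ψ = n≡ (suc c) ∷ [] ; α = β ; a = 0 ; b = 1 ; 1≤b = ℕ.s≤s ℕ.z≤n }
  G : Seq m
  G n x = evalPE (shifted ∷ []) n x
  rec : Solves 0 (λ n x → at c n * evalAff β x) G
  rec n x = begin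
    at (suc c) (suc n) * α * 1ℚ * ℕ→ℚ (1 ℕ.^ suc n) + 0ℚ  ≡⟨ cong₂ (λ T u → T * α * 1ℚ * ℕ→ℚ u + 0ℚ) (at-suc c n) (ℕP.^-zeroˡ (suc n)) ⟩
    at c n * α * 1ℚ * 1ℚ + 0ℚ                             ≡⟨ solve 3 (λ T α G → T :* α :* con 1ℚ :* con 1ℚ :+ con 0ℚ := con 0ℚ :* G :+ T :* α) refl (at c n) α (G n x) ⟩
    0ℚ * G n x + at c n * α                               ∎
    where
    open ≡-Reasoning
    α = evalAff β x
solvable-at {m} β l@(suc _) c = solvable G (tail ∷ [] , represents) rec
  where
  instance
    l^c+1-nonZero : ℕ.NonZero (l ℕ.^ suc c)
    l^c+1-nonZero = ℕP.m^n≢0 l (suc c)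
  r = inv (l ℕ.^ suc c)
  G : Seq m
  G n x = ⟦ beyond c ⟧ n * (r * evalAff β x) * ℕ→ℚ (l ℕ.^ n)
  tail : PETerm m
  tail = record { ψ = beyond c ; α = scaleAff r β ; a = 0 ; b = l ; 1≤b = ℕ.s≤s ℕ.z≤n }
  represents : ∀ n x → evalPE (tail ∷ []) n x ≡ G n x
  represents n x = trans (cong (λ α → ⟦ beyond c ⟧ n * α * 1ℚ * ℕ→ℚ (l ℕ.^ n) + 0ℚ) (evalAff-scale r β x))
    (solve 3 (λ I α L → I :* α :* con 1ℚ :* L :+ con 0ℚ := I :* α :* L) refl (⟦ beyond c ⟧ n) (r * evalAff β x) (ℕ→ℚ (l ℕ.^ n)))
  rec : Solves l (λ n x → at c n * evalAff β x) G
  rec n x = begin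
    ⟦ beyond c ⟧ (suc n) * (r * α) * ℕ→ℚ (l ℕ.^ suc n)  ≡⟨ cong₂ (λ u v → u * (r * α) * v) (beyond-step c n) (ℕ→ℚ-^suc l n) ⟩
    (T + I) * (r * α) * (L * Lⁿ)                        ≡⟨ solve 6 (λ T I r α L Lⁿ → (T :+ I) :* (r :* α) :* (L :* Lⁿ)
                                                                         := T :* (L :* Lⁿ :* r) :* α :+ L :* (I :* (r :* α) :* Lⁿ)) refl T I r α L Lⁿ ⟩
    T * (L * Lⁿ * r) * α + L * G n x                    ≡⟨ cong (λ z → T * (z * r) * α + L * G n x) (ℕ→ℚ-^suc l n) ⟨
    T * (ℕ→ℚ (l ℕ.^ suc n) * r) * α + L * G n x         ≡⟨ cong (λ z → z * α + L * G n x) (at-sift c n (λ k → ℕ→ℚ (l ℕ.^ suc k) * r)) ⟩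
    T * (ℕ→ℚ (l ℕ.^ suc c) * r) * α + L * G n x         ≡⟨ cong (λ z → T * z * α + L * G n x) (inv-inverseʳ (l ℕ.^ suc c)) ⟩
    T * 1ℚ * α + L * G n x                              ≡⟨ solve 3 (λ T α Y → T :* con 1ℚ :* α :+ Y := Y :+ T :* α) refl T α (L * G n x) ⟩
    L * G n x + T * α                                   ∎
    where
    open ≡-Reasoning
    α = evalAff β x
    T = at c n
    I = ⟦ beyond c ⟧ n
    L = ℕ→ℚ l
    Lⁿ = ℕ→ℚ (l ℕ.^ n)

termSeq : ∀ {m} → Conj → Affine m → ℕ → ℕ → Seq m
termSeq ψ α a b n x = ⟦ ψ ⟧ n * evalAff α x * ℕ→ℚ (n ℕ.^ a) * ℕ→ℚ (b ℕ.^ n)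

profile : Conj → ℕ → ℕ → ℕ → ℚ
profile ψ a b n = ⟦ ψ ⟧ n * ℕ→ℚ (n ℕ.^ a) * ℕ→ℚ (b ℕ.^ n)

at-termSeq : ∀ {m} c ψ (α : Affine m) a b n x →
  at c n * termSeq ψ α a b n x ≡ profile ψ a b c * (at c n * evalAff α x)
at-termSeq c ψ α a b n x = begin
  T * (Ψ * A * P * B)        ≡⟨ solve 5 (λ T Ψ A P B → T :* (Ψ :* A :* P :* B) := T :* (Ψ :* P :* B) :* A) refl T Ψ A P B ⟩
  T * profile ψ a b n * A    ≡⟨ cong (_* A) (at-sift c n (profile ψ a b)) ⟩
  T * profile ψ a b c * A    ≡⟨ solve 3 (λ T Q A → T :* Q :* A := Q :* (T :* A)) refl T (profile ψ a b c) A ⟩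
  profile ψ a b c * (T * A)  ∎
  where
  open ≡-Reasoning
  T = at c n
  Ψ = ⟦ ψ ⟧ n
  A = evalAff α x
  P = ℕ→ℚ (n ℕ.^ a)
  B = ℕ→ℚ (b ℕ.^ n)

termSeq-n≡ : ∀ {m} c ψ (α : Affine m) a b n x → termSeq (n≡ c ∷ ψ) α a b n x ≡ at c n * termSeq ψ α a b n x
termSeq-n≡ c ψ α a b n x rewrite ⟦n≡∷⟧ c ψ n =
  solve 5 (λ T Ψ A P B → T :* Ψ :* A :* P :* B := T :* (Ψ :* A :* P :* B)) refl
    (at c n) (⟦ ψ ⟧ n) (evalAff α x) (ℕ→ℚ (n ℕ.^ a)) (ℕ→ℚ (b ℕ.^ n))

termSeq-n≢ : ∀ {m} c ψ (α : Affine m) a b n x →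
  termSeq (n≢ c ∷ ψ) α a b n x ≡ termSeq ψ α a b n x - at c n * termSeq ψ α a b n x
termSeq-n≢ c ψ α a b n x rewrite ⟦n≢∷⟧ c ψ n =
  solve 5 (λ T Ψ A P B → (con 1ℚ :- T) :* Ψ :* A :* P :* B := Ψ :* A :* P :* B :- T :* (Ψ :* A :* P :* B)) refl
    (at c n) (⟦ ψ ⟧ n) (evalAff α x) (ℕ→ℚ (n ℕ.^ a)) (ℕ→ℚ (b ℕ.^ n))

-- Every term is solvable, by induction on its condition ψ: a literal
-- n = c restricts to a multiple of [n = c]·α, and n ≠ c subtracts one.
solvable-termSeq : ∀ {m} l (α : Affine m) a b → 1 ≤ b → ∀ ψ → Solvable l (termSeq ψ α a b)
solvable-termSeq l α a b 1≤b [] =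
  solvable-ext (λ n x → solve 3 (λ A P B → A :* P :* B := con 1ℚ :* A :* P :* B) refl
                          (evalAff α x) (ℕ→ℚ (n ℕ.^ a)) (ℕ→ℚ (b ℕ.^ n)))
    (solvable-pure α l b 1≤b a)
solvable-termSeq l α a b 1≤b (n≡ c ∷ ψ) =
  solvable-ext (λ n x → sym (trans (termSeq-n≡ c ψ α a b n x) (at-termSeq c ψ α a b n x)))
    (solvable-scale (profile ψ a b c) (solvable-at α l c))
solvable-termSeq l α a b 1≤b (n≢ c ∷ ψ) =
  solvable-ext removed
    (solvable-+ (solvable-termSeq l α a b 1≤b ψ) (solvable-scale (- profile ψ a b c) (solvable-at α l c)))
  where
  removed : ∀ n x → termSeq ψ α a b n x + (- profile ψ a b c) * (at c n * evalAff α x) ≡ termSeq (n≢ c ∷ ψ) α a b n x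
  removed n x = begin
    S + (- Q) * R  ≡⟨ solve 3 (λ S Q R → S :+ (:- Q) :* R := S :- Q :* R) refl S Q R ⟩
    S - Q * R      ≡⟨ cong (_-_ S) (at-termSeq c ψ α a b n x) ⟨
    S - at c n * S ≡⟨ termSeq-n≢ c ψ α a b n x ⟨
    termSeq (n≢ c ∷ ψ) α a b n x ∎
    where
    open ≡-Reasoning
    S = termSeq ψ α a b n x
    Q = profile ψ a b c
    R = at c n * evalAff α x

solvable-PE : ∀ {m} l (e : PE m) → Solvable l (evalPE e)
solvable-PE l [] = solvable (λ _ _ → 0ℚ) ([] , λ _ _ → refl) λ n x → sym (trans (ℚP.+-identityʳ _) (ℚP.*-zeroʳ (ℕ→ℚ l)))
solvable-PE l (t ∷ e) =
  solvable-+ (solvable-termSeq l (PETerm.α t) (PETerm.a t) (PETerm.b t) (PETerm.1≤b t) (PETerm.ψ t)) (solvable-PE l e)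

solvable-rep : ∀ {m} l {f : Seq m} → Rep f → Solvable l f
solvable-rep l (e , e≡f) = solvable-ext e≡f (solvable-PE l e)

homogeneous : ∀ {m} → ℕ → Affine m → PETerm m
homogeneous zero      γ = record { ψ = n≡ 0 ∷ [] ; α = γ ; a = 0 ; b = 1 ; 1≤b = ℕ.s≤s ℕ.z≤n }
homogeneous (suc l′) γ = record { ψ = [] ; α = γ ; a = 0 ; b = suc l′ ; 1≤b = ℕ.s≤s ℕ.z≤n }

homogeneous-0 : ∀ {m} l (γ : Affine m) x → evalTerm (homogeneous l γ) 0 x ≡ evalAff γ x
homogeneous-0 zero γ x = trans (cong (λ T → T * evalAff γ x * 1ℚ * 1ℚ) (at-self 0))
  (solve 1 (λ g → con 1ℚ :* g :* con 1ℚ :* con 1ℚ := g) refl (evalAff γ x))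
homogeneous-0 (suc l′) γ x = solve 1 (λ g → con 1ℚ :* g :* con 1ℚ :* con 1ℚ := g) refl (evalAff γ x)

homogeneous-suc : ∀ {m} l (γ : Affine m) n x →
  evalTerm (homogeneous l γ) (suc n) x ≡ ℕ→ℚ l * evalTerm (homogeneous l γ) n x
homogeneous-suc zero γ n x = begin
  at 0 (suc n) * evalAff γ x * 1ℚ * ℕ→ℚ (1 ℕ.^ suc n)  ≡⟨ cong (λ T → T * evalAff γ x * 1ℚ * ℕ→ℚ (1 ℕ.^ suc n)) (at-other 0 (suc n) (λ ())) ⟩
  0ℚ * evalAff γ x * 1ℚ * ℕ→ℚ (1 ℕ.^ suc n)            ≡⟨ solve 2 (λ g u → con 0ℚ :* g :* con 1ℚ :* u := con 0ℚ) refl (evalAff γ x) (ℕ→ℚ (1 ℕ.^ suc n)) ⟩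
  0ℚ                                                   ≡⟨ ℚP.*-zeroˡ (evalTerm (homogeneous 0 γ) n x) ⟨
  0ℚ * evalTerm (homogeneous 0 γ) n x                  ∎
  where open ≡-Reasoning
homogeneous-suc l@(suc _) γ n x = trans (cong (λ B → 1ℚ * evalAff γ x * 1ℚ * B) (ℕ→ℚ-^suc l n))
  (solve 3 (λ g L B → con 1ℚ :* g :* con 1ℚ :* (L :* B) := L :* (con 1ℚ :* g :* con 1ℚ :* B)) refl
    (evalAff γ x) (ℕ→ℚ l) (ℕ→ℚ (l ℕ.^ n)))

Homogeneous : ∀ {m} → ℕ → PE m → Set
Homogeneous l e = ∀ n x → evalPE e (suc n) x ≡ ℕ→ℚ l * evalPE e n x

homogeneous-map : ∀ {m} l (γs : List (Affine m)) → Homogeneous l (List.map (homogeneous l) γs)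
homogeneous-map l []       n x = sym (ℚP.*-zeroʳ (ℕ→ℚ l))
homogeneous-map l (γ ∷ γs) n x =
  trans (cong₂ _+_ (homogeneous-suc l γ n x) (homogeneous-map l γs n x)) (sym (ℚP.*-distribˡ-+ (ℕ→ℚ l) _ _))

-- At n = 0 a term ⟦ψ⟧·α·n^a·b^n is the affine expression profile(0)·α;
-- its negation is the initial value the correction must supply.
negatedInitial : ∀ {m} → PETerm m → Affine m
negatedInitial t = scaleAff (- profile (PETerm.ψ t) (PETerm.a t) (PETerm.b t) 0) (PETerm.α t)

cancels-initial : ∀ {m} l (e : PE m) x →
  evalPE (List.map (homogeneous l) (List.map negatedInitial e)) 0 x ≡ - evalPE e 0 x
cancels-initial l []      x = refl
cancels-initial l (t ∷ e) x = begin
  evalTerm (homogeneous l (negatedInitial t)) 0 x + evalPE (List.map (homogeneous l) (List.map negatedInitial e)) 0 x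
    ≡⟨ cong₂ _+_ (trans (homogeneous-0 l (negatedInitial t) x) (evalAff-scale (- profile (PETerm.ψ t) (PETerm.a t) (PETerm.b t) 0) (PETerm.α t) x)) (cancels-initial l e x) ⟩
  (- (Ψ * P * B)) * A + - R
    ≡⟨ solve 5 (λ Ψ A P B R → (:- (Ψ :* P :* B)) :* A :+ (:- R) := :- (Ψ :* A :* P :* B :+ R)) refl Ψ A P B R ⟩
  - (Ψ * A * P * B + R)  ∎
  where
  open ≡-Reasoning
  Ψ = ⟦ PETerm.ψ t ⟧ 0
  A = evalAff (PETerm.α t) x
  P = ℕ→ℚ (0 ℕ.^ PETerm.a t)
  B = ℕ→ℚ (PETerm.b t ℕ.^ 0)
  R = evalPE e 0 x

-- The scalar initial value problem q(n+1) = l·q(n) + f(n), q(0) = γ, has a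
-- poly-exponential solution for representable f: a particular solution e
-- plus homogeneous terms replacing its initial value e(0) by γ.
solveScalar : ∀ {m} l {f : Seq m} → Rep f → (γ : Affine m) →
  Σ (PE m) λ q → (∀ x → evalPE q 0 x ≡ evalAff γ x) × Solves l f (evalPE q)
solveScalar l {f} rep γ with solvable-rep l rep
... | solvable G (e , e≡G) sol = e ++ correction , initial , step
  where
  correction = List.map (homogeneous l) (γ ∷ List.map negatedInitial e)
  initial : ∀ x → evalPE (e ++ correction) 0 x ≡ evalAff γ x
  initial x = begin
    evalPE (e ++ correction) 0 x            ≡⟨ evalPE-++ e correction 0 x ⟩
    E + (evalTerm (homogeneous l γ) 0 x + _) ≡⟨ cong₂ (λ u v → E + (u + v)) (homogeneous-0 l γ x) (cancels-initial l e x) ⟩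
    E + (evalAff γ x + - E)                 ≡⟨ solve 2 (λ E g → E :+ (g :+ :- E) := g) refl E (evalAff γ x) ⟩
    evalAff γ x                             ∎
    where
    open ≡-Reasoning
    E = evalPE e 0 x
  step : Solves l f (evalPE (e ++ correction))
  step n x = begin
    evalPE (e ++ correction) (suc n) x              ≡⟨ evalPE-++ e correction (suc n) x ⟩
    evalPE e (suc n) x + evalPE correction (suc n) x ≡⟨ cong₂ _+_ (trans (e≡G (suc n) x) (sol n x)) (homogeneous-map l (γ ∷ List.map negatedInitial e) n x) ⟩
    (L * G n x + f n x) + L * K                     ≡⟨ cong (λ g → (L * g + f n x) + L * K) (e≡G n x) ⟨
    (L * E + f n x) + L * K                         ≡⟨ solve 4 (λ L E F K → (L :* E :+ F) :+ L :* K := L :* (E :+ K) :+ F) refl L E (f n x) K ⟩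
    L * (E + K) + f n x                             ≡⟨ cong (λ s → L * s + f n x) (evalPE-++ e correction n x) ⟨
    L * evalPE (e ++ correction) n x + f n x         ∎
    where
    open ≡-Reasoning
    L = ℕ→ℚ l
    E = evalPE e n x
    K = evalPE correction n x

-- One row of the system: the diagonal entry a ≥ 0 is a natural number, so
-- the scalar problem applies.
solveRow : ∀ {m} (a : ℤ) → + 0 ≤ℤ a → {f : Seq m} → Rep f → (γ : Affine m) →
  Σ (PE m) λ q → (∀ x → evalPE q 0 x ≡ evalAff γ x) × (∀ n x → evalPE q (suc n) x ≡ ℤ→ℚ a * evalPE q n x + f n x)
solveRow (+ k) _ rep γ = solveScalar k rep γ

rep-linear : ∀ {m} d (c : Fin d → ℚ) (q : Fin d → PE m) → Rep (λ n x → Σℚ d (λ j → c j * evalPE (q j) n x))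
rep-linear zero    c q = [] , λ _ _ → refl
rep-linear (suc d) c q =
  rep-+ (rep-scale (c zero) (q zero , λ _ _ → refl)) (rep-linear d (λ j → c (suc j)) (λ j → q (suc j)))

SystemSolution : ∀ {m} d → (Fin d → Fin d → ℤ) → (Fin d → PE m) → (Fin d → Affine m) → Set
SystemSolution {m} d A p γ = Σ (Fin d → PE m) λ q →
  (∀ x i → evalPE (q i) 0 x ≡ evalAff (γ i) x)
  × (∀ n x i → evalPE (q i) (suc n) x ≡ Σℚ d (λ j → ℤ→ℚ (A i j) * evalPE (q j) n x) + evalPE (p i) n x)

NonnegativeDiagonal : ∀ {d} → (Fin d → Fin d → ℤ) → Set
NonnegativeDiagonal {d} A = ∀ i → + 0 ≤ℤ A i i

zero-coefficient : ∀ {a} → a ≡ + 0 → ∀ Q S P → S + P ≡ ℤ→ℚ a * Q + S + P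
zero-coefficient refl Q S P = solve 3 (λ Q S P → S :+ P := con 0ℚ :* Q :+ S :+ P) refl Q S P

-- Upper triangular systems: the last d rows form an upper triangular
-- system on their own; row 0 is then a scalar problem forced by p₀ and
-- the already solved components.
solveUpper : ∀ {m} d (A : Fin d → Fin d → ℤ) → UpperTriangular A → NonnegativeDiagonal A →
  (p : Fin d → PE m) (γ : Fin d → Affine m) → SystemSolution d A p γ
solveUpper zero    A upper nonneg p γ = (λ ()) , (λ x ()) , (λ n x ())
solveUpper (suc d) A upper nonneg p γ = q , initial , step
  where
  rest = solveUpper d (λ i j → A (suc i) (suc j)) (λ i j j<i → upper (suc i) (suc j) (ℕ.s≤s j<i))
                      (λ i → nonneg (suc i)) (λ i → p (suc i)) (λ i → γ (suc i))
  q′ = proj₁ rest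
  first = solveRow (A zero zero) (nonneg zero)
            (rep-+ (rep-linear d (λ j → ℤ→ℚ (A zero (suc j))) q′) (p zero , λ _ _ → refl)) (γ zero)
  q = λ { zero → proj₁ first ; (suc i) → q′ i }
  initial : ∀ x i → evalPE (q i) 0 x ≡ evalAff (γ i) x
  initial x zero    = proj₁ (proj₂ first) x
  initial x (suc i) = proj₁ (proj₂ rest) x i
  step : ∀ n x i → evalPE (q i) (suc n) x ≡ Σℚ (suc d) (λ j → ℤ→ℚ (A i j) * evalPE (q j) n x) + evalPE (p i) n x
  step n x zero    = trans (proj₂ (proj₂ first) n x)
    (sym (ℚP.+-assoc (ℤ→ℚ (A zero zero) * evalPE (q zero) n x)
                     (Σℚ d (λ j → ℤ→ℚ (A zero (suc j)) * evalPE (q′ j) n x)) (evalPE (p zero) n x)))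
  step n x (suc i) = trans (proj₂ (proj₂ rest) n x i)
    (zero-coefficient (upper (suc i) zero (ℕ.s≤s ℕ.z≤n)) (evalPE (q zero) n x) _ (evalPE (p (suc i)) n x))

-- Lower triangular systems: row 0 is a scalar problem by itself; its
-- solution q₀ then enters the remaining lower triangular system as extra
-- forcing A_{i0}·q₀.
solveLower : ∀ {m} d (A : Fin d → Fin d → ℤ) → LowerTriangular A → NonnegativeDiagonal A →
  (p : Fin d → PE m) (γ : Fin d → Affine m) → SystemSolution d A p γ
solveLower zero    A lower nonneg p γ = (λ ()) , (λ x ()) , (λ n x ())
solveLower (suc d) A lower nonneg p γ = q , initial , step
  where
  first = solveRow (A zero zero) (nonneg zero) (p zero , λ _ _ → refl) (γ zero)
  q₀ = proj₁ first
  rest = solveLower d (λ i j → A (suc i) (suc j)) (λ i j i<j → lower (suc i) (suc j) (ℕ.s≤s i<j))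
                      (λ i → nonneg (suc i)) (λ i → p (suc i) ++ scalePE (ℤ→ℚ (A (suc i) zero)) q₀) (λ i → γ (suc i))
  q′ = proj₁ rest
  q = λ { zero → q₀ ; (suc i) → q′ i }
  initial : ∀ x i → evalPE (q i) 0 x ≡ evalAff (γ i) x
  initial x zero    = proj₁ (proj₂ first) x
  initial x (suc i) = proj₁ (proj₂ rest) x i
  step : ∀ n x i → evalPE (q i) (suc n) x ≡ Σℚ (suc d) (λ j → ℤ→ℚ (A i j) * evalPE (q j) n x) + evalPE (p i) n x
  step n x zero = begin
    evalPE q₀ (suc n) x      ≡⟨ proj₂ (proj₂ first) n x ⟩
    D + P                    ≡⟨ cong (_+ P) (ℚP.+-identityʳ D) ⟨
    D + 0ℚ + P               ≡⟨ cong (λ s → D + s + P) above-diagonal ⟨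
    D + S + P                ∎
    where
    open ≡-Reasoning
    D = ℤ→ℚ (A zero zero) * evalPE q₀ n x
    P = evalPE (p zero) n x
    S = Σℚ d (λ j → ℤ→ℚ (A zero (suc j)) * evalPE (q′ j) n x)
    above-diagonal : S ≡ 0ℚ
    above-diagonal = trans (Σℚ-cong d (λ j → trans (cong (λ a → ℤ→ℚ a * evalPE (q′ j) n x) (lower zero (suc j) (ℕ.s≤s ℕ.z≤n)))
                                                     (ℚP.*-zeroˡ (evalPE (q′ j) n x))))
                           (Σℚ-zero d)
  step n x (suc i) = begin
    evalPE (q′ i) (suc n) x                          ≡⟨ proj₂ (proj₂ rest) n x i ⟩
    S + evalPE (p (suc i) ++ scalePE c q₀) n x        ≡⟨ cong (_+_ S) (trans (evalPE-++ (p (suc i)) _ n x) (cong (_+_ P) (evalPE-scale c q₀ n x))) ⟩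
    S + (P + c * evalPE q₀ n x)                      ≡⟨ solve 4 (λ S P c Q → S :+ (P :+ c :* Q) := c :* Q :+ S :+ P) refl S P c (evalPE q₀ n x) ⟩
    c * evalPE q₀ n x + S + P                        ∎
    where
    open ≡-Reasoning
    c = ℤ→ℚ (A (suc i) zero)
    P = evalPE (p (suc i)) n x
    S = Σℚ d (λ j → ℤ→ℚ (A (suc i) (suc j)) * evalPE (q′ j) n x)

solveTriangular : ∀ {m} d (A : Fin d → Fin d → ℤ) → Triangular A → NonnegativeDiagonal A →
  (p : Fin d → PE m) (γ : Fin d → Affine m) → SystemSolution d A p γ
solveTriangular d A (inj₁ upper) = solveUpper d A upper
solveTriangular d A (inj₂ lower) = solveLower d A lower

lemma6 : (m d : ℕ) → 1 ≤ d → (d≤m : d ≤ m)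
    → (A : Fin d → Fin d → Data.Integer.ℤ)
    → Triangular A
    → (∀ (i : Fin d) → + 0 ≤ℤ A i i)
    → (p : Fin d → PE m)
    → Σ (Fin d → PE m) (λ q →
        (∀ (x : Fin m → ℚ) (i : Fin d) → evalPE (q i) 0 x ≡ x (inject≤ i d≤m))
        × (∀ (n : ℕ) (x : Fin m → ℚ) (i : Fin d) →
             evalPE (q i) (suc n) x
               ≡ Σℚ d (λ j → ℤ→ℚ (A i j) * evalPE (q j) n x) + evalPE (p i) n x))
lemma6 m d _ d≤m A triangular nonneg p
  with solveTriangular d A triangular nonneg p (λ i → var (inject≤ i d≤m))
... | q , initial , step = q , (λ x i → trans (initial x i) (evalAff-var (inject≤ i d≤m) x)) , step
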